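{- Let $n\ge1$, and let $q,t,a$ be indeterminates (generic parameters). Define $G_r(x;q,t)$, $r\ge0$, for $x=(x_1,\dots,x_n)$ by $$\prod_{i=1}^n\frac{(tux_i;q)_\infty}{(ux_i;q)_\infty}\,\frac{(tu/x_i;q)_\infty}{(u/x_i;q)_\infty}=\sum_{r\ge0}u^rG_r(x;q,t).$$ Then for every positive integer $r$, $$G_r(t^{n-1}a,t^{n-2}a,\dots,ta,a;q,t)=a^r\frac{(t^n;q)_r}{(q;q)_r}\ {}_2\phi_1\!\left[\begin{matrix}q^{ -r},\ t^n\\ t^{ -n}q^{1-r}\end{matrix};q,\frac{qt^{1-2n}}{a^2}\right].$$
   Context: $(b;q)_\infty=\prod_{i\ge0}(1-bq^i)$ and $(b;q)_k=\prod_{i=0}^{k-1}(1-bq^i)$; here $0<|q|<1$ or these are formal power series in $u$. ${}_2\phi_1\!\left[\begin{matrix}a_1,a_2\\ b_1\end{matrix};q,z\right]=\sum_{i\ge0}\frac{(a_1;q)_i(a_2;q)_i}{(b_1;q)_i}\frac{z^i}{(q;q)_i}$ (terminating here since $a_1=q^{ -r}$). -}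

module Defs where

open import Level using (Level; suc; _⊔_)
open import Data.Nat using (ℕ; zero; _∸_) renaming (suc to sucℕ; _*_ to _*ℕ_; _+_ to _+ℕ_)
open import Data.Nat.DivMod using (_/_)
open import Data.List using (List; []; _∷_; foldr; map; downFrom)
open import Relation.Nullary using (¬_)
open import Algebra.Bundles using (CommutativeRing)

-- A field: a commutative ring with 1 ≠ 0 and an inverse operation that is a
-- multiplicative inverse on every nonzero element (its value at 0 is irrelevant).
record Field (c ℓ : Level) : Set (suc (c ⊔ ℓ)) where
  field
    commRing : CommutativeRing c ℓ
  open CommutativeRing commRing public
  field
    _⁻¹     : Carrier → Carrier
    1≉0     : ¬ (1# ≈ 0#)
    ⁻¹-inverse : ∀ x → ¬ (x ≈ 0#) → x * (x ⁻¹) ≈ 1#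

module FieldDefs {c ℓ : Level} (F : Field c ℓ) where
  open Field F using (Carrier; _≈_; _+_; _*_; -_; _-_; 0#; 1#; _⁻¹)

  pow : Carrier → ℕ → Carrier
  pow x zero = 1#
  pow x (sucℕ k) = x * pow x k

  infixl 7 _÷_
  _÷_ : Carrier → Carrier → Carrier
  x ÷ y = x * (y ⁻¹)

  qPoch : Carrier → Carrier → ℕ → Carrier
  qPoch b q zero = 1#
  qPoch b q (sucℕ k) = qPoch b q k * (1# - b * pow q k)

  sumTo : ℕ → (ℕ → Carrier) → Carrier
  sumTo zero f = f zero
  sumTo (sucℕ N) f = sumTo N f + f (sucℕ N)

  -- formal power series in u (coefficient sequences) and their Cauchy product
  Series : Set c
  Series = ℕ → Carrier

  oneS : Series
  oneS zero = 1#
  oneS (sucℕ k) = 0#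

  _⊛_ : Series → Series → Series
  (f ⊛ g) k = sumTo k (λ j → f j * g (k ∸ j))

  -- (b u; q)_∞ as a formal power series in u (Euler's expansion):
  -- coefficient of u^k is (-1)^k q^{k(k-1)/2} b^k / (q;q)_k
  infProd : Carrier → Carrier → Series
  infProd b q k =
    pow (- 1#) k * pow q ((k *ℕ (k ∸ 1)) / 2) * pow b k ÷ qPoch q q k

  -- 1 / (b u; q)_∞ as a formal power series in u (Euler's expansion):
  -- coefficient of u^k is b^k / (q;q)_k
  invInfProd : Carrier → Carrier → Series
  invInfProd b q k = pow b k ÷ qPoch q q k

  factor : Carrier → Carrier → Carrier → Series
  factor q t x =
    ((infProd (t * x) q ⊛ invInfProd x q) ⊛ infProd (t * (x ⁻¹)) q) ⊛ invInfProd (x ⁻¹) q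

  G : ℕ → List Carrier → Carrier → Carrier → Carrier
  G r xs q t = foldr (λ x s → factor q t x ⊛ s) oneS xs r

  geomPoint : ℕ → Carrier → Carrier → List Carrier
  geomPoint n t a = map (λ j → pow t j * a) (downFrom n)

  -- terminating 2φ1 with a1 = q^{-N}: sum over i = 0..N
  phi21 : ℕ → Carrier → Carrier → Carrier → Carrier → Carrier → Carrier
  phi21 N a1 a2 b1 q z =
    sumTo N (λ i → (qPoch a1 q i * qPoch a2 q i ÷ qPoch b1 q i) * (pow z i ÷ qPoch q q i))

{-# OPTIONS --safe #-}
-- Write P(c, b) for the q-binomial series Σ_k (c;q)_k (b u)^k / (q;q)_k of (c b u;q)_∞ / (b u;q)_∞.
-- A power series with given constant term is determined by a first-order q-difference equation
-- (1 - α u) f(u) = (1 - β u) f(q u); this proves the q-binomial theorem and, by telescoping,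
-- P(c, d b) P(d, b) = P(c d, b). Each factor of the product is P(t, x) P(t, 1/x), and at the point
-- x_j = t^j a the factors telescope to P(t^n, a) P(t^n, t^(1-n)/a). The coefficient of u^r of this
-- product is Σ_i P(t^n, a)_(r-i) P(t^n, t^(1-n)/a)_i, and reversing (t^n;q)_(r-i) in terms of
-- (t^n;q)_r and (q^(1-r) t^(-n);q)_i turns it term by term into the 2φ1.
module Submission where

open import Defs
open import Level using (Level)
open import Data.Nat using (ℕ; _≤_) renaming (_+_ to _+ℕ_)
open import Relation.Nullary using (¬_)

open import Algebra.Bundles using (CommutativeRing)
open import Data.Nat as ℕ using (zero; suc; _∸_)
import Data.Nat.Properties as ℕₚ
open import Data.Nat.DivMod using (_/_; m*n/n≡m; +-distrib-/-∣ʳ)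
open import Data.Nat.Divisibility using (divides-refl)
open import Data.Nat.Tactic.RingSolver using (solve-∀)
open import Data.Integer as ℤ using (ℤ; +_; -[1+_]; _⊖_)
import Data.Integer.Properties as ℤ
open import Data.List using (foldr)
open import Data.Maybe using (Maybe; map)
open import Relation.Binary.Bundles using (Setoid)
open import Relation.Binary.Consequences using (dec⇒weaklyDec)
open import Relation.Binary.PropositionalEquality as ≡ using (_≡_)
import Algebra.Solver.Ring.AlmostCommutativeRing as ACR
import Relation.Binary.Reasoning.Setoid as SetoidReasoning

-- Algebra.Solver.Ring for an arbitrary commutative ring with coefficients in ℤ (the solvers of
-- Tactic.RingSolver take the ring itself as coefficients, so they cannot cancel x - x). The
-- type-checking optimised _×_ makes con (+ 1) denote 1# itself.
module CommutativeRingSolver {c ℓ : Level} (R : CommutativeRing c ℓ) where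
  open CommutativeRing R
  open import Algebra.Properties.Ring ring using (-‿distribˡ-*; -‿distribʳ-*; -0#≈0#)
  open import Algebra.Properties.Group +-group using (⁻¹-involutive)
  open import Algebra.Properties.AbelianGroup +-abelianGroup using (⁻¹-∙-comm)
  open import Algebra.Properties.CommutativeSemigroup +-commutativeSemigroup using (interchange)
  open import Algebra.Properties.Semiring.Mult.TCOptimised semiring using (_×_; 1+×; ×-homo-+; ×1-homo-*)
  open import Relation.Binary.Reasoning.Setoid setoid

  fromℤ : ℤ → Carrier
  fromℤ (+ n)    = n × 1#
  fromℤ -[1+ n ] = - (suc n × 1#)

  1+x-[1+y]≈x-y : ∀ x y → (1# + x) - (1# + y) ≈ x - y
  1+x-[1+y]≈x-y x y = begin
    (1# + x) + - (1# + y)    ≈⟨ +-congˡ (⁻¹-∙-comm 1# y) ⟨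
    (1# + x) + (- 1# + - y)  ≈⟨ interchange 1# x (- 1#) (- y) ⟩
    (1# - 1#) + (x - y)      ≈⟨ +-congʳ (-‿inverseʳ 1#) ⟩
    0# + (x - y)             ≈⟨ +-identityˡ (x - y) ⟩
    x - y                    ∎

  fromℤ-⊖ : ∀ m n → fromℤ (m ⊖ n) ≈ m × 1# - n × 1#
  fromℤ-⊖ zero    zero    = sym (trans (+-congˡ -0#≈0#) (+-identityʳ 0#))
  fromℤ-⊖ zero    (suc n) = sym (+-identityˡ _)
  fromℤ-⊖ (suc m) zero    = sym (trans (+-congˡ -0#≈0#) (+-identityʳ _))
  fromℤ-⊖ (suc m) (suc n) = begin
    fromℤ (suc m ⊖ suc n)          ≡⟨ ≡.cong fromℤ (ℤ.[1+m]⊖[1+n]≡m⊖n m n) ⟩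
    fromℤ (m ⊖ n)                  ≈⟨ fromℤ-⊖ m n ⟩
    m × 1# - n × 1#                ≈⟨ 1+x-[1+y]≈x-y (m × 1#) (n × 1#) ⟨
    (1# + m × 1#) - (1# + n × 1#)  ≈⟨ +-cong (1+× m 1#) (-‿cong (1+× n 1#)) ⟨
    suc m × 1# - suc n × 1#        ∎

  fromℤ-neg : ∀ i → fromℤ (ℤ.- i) ≈ - fromℤ i
  fromℤ-neg -[1+ n ]    = sym (⁻¹-involutive _)
  fromℤ-neg (+ zero)    = sym -0#≈0#
  fromℤ-neg (+ (suc n)) = refl

  fromℤ-+ : ∀ i j → fromℤ (i ℤ.+ j) ≈ fromℤ i + fromℤ j
  fromℤ-+ (+ m)    (+ n)    = ×-homo-+ 1# m n
  fromℤ-+ (+ m)    -[1+ n ] = fromℤ-⊖ m (suc n)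
  fromℤ-+ -[1+ m ] (+ n)    = trans (fromℤ-⊖ n (suc m)) (+-comm _ _)
  fromℤ-+ -[1+ m ] -[1+ n ] = begin
    fromℤ (-[1+ m ] ℤ.+ -[1+ n ])          ≡⟨ ≡.cong fromℤ (ℤ.neg-distrib-+ (+ suc m) (+ suc n)) ⟨
    fromℤ (ℤ.- (+ suc m ℤ.+ + suc n))      ≈⟨ fromℤ-neg (+ suc m ℤ.+ + suc n) ⟩
    - fromℤ (+ suc m ℤ.+ + suc n)          ≈⟨ -‿cong (fromℤ-+ (+ suc m) (+ suc n)) ⟩
    - (suc m × 1# + suc n × 1#)            ≈⟨ ⁻¹-∙-comm _ _ ⟨
    fromℤ -[1+ m ] + fromℤ -[1+ n ]        ∎

  fromℤ-+* : ∀ m j → fromℤ (+ m ℤ.* j) ≈ fromℤ (+ m) * fromℤ j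
  fromℤ-+* m (+ n) = begin
    fromℤ (+ m ℤ.* + n)        ≡⟨ ≡.cong fromℤ (ℤ.pos-* m n) ⟨
    (m ℕ.* n) × 1#             ≈⟨ ×1-homo-* m n ⟩
    fromℤ (+ m) * fromℤ (+ n)  ∎
  fromℤ-+* m -[1+ n ] = begin
    fromℤ (+ m ℤ.* -[1+ n ])           ≡⟨ ≡.cong fromℤ (ℤ.neg-distribʳ-* (+ m) (+ suc n)) ⟨
    fromℤ (ℤ.- (+ m ℤ.* + suc n))      ≈⟨ fromℤ-neg (+ m ℤ.* + suc n) ⟩
    - fromℤ (+ m ℤ.* + suc n)          ≈⟨ -‿cong (fromℤ-+* m (+ suc n)) ⟩
    - (fromℤ (+ m) * fromℤ (+ suc n))  ≈⟨ -‿distribʳ-* _ _ ⟩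
    fromℤ (+ m) * fromℤ -[1+ n ]       ∎

  fromℤ-* : ∀ i j → fromℤ (i ℤ.* j) ≈ fromℤ i * fromℤ j
  fromℤ-* (+ m)    j = fromℤ-+* m j
  fromℤ-* -[1+ m ] j = begin
    fromℤ (-[1+ m ] ℤ.* j)         ≡⟨ ≡.cong fromℤ (ℤ.neg-distribˡ-* (+ suc m) j) ⟨
    fromℤ (ℤ.- (+ suc m ℤ.* j))    ≈⟨ fromℤ-neg (+ suc m ℤ.* j) ⟩
    - fromℤ (+ suc m ℤ.* j)        ≈⟨ -‿cong (fromℤ-+* (suc m) j) ⟩
    - (fromℤ (+ suc m) * fromℤ j)  ≈⟨ -‿distribˡ-* _ _ ⟩
    fromℤ -[1+ m ] * fromℤ j       ∎

  fromℤ-morphism : ℤ.+-*-rawRing ACR.-Raw-AlmostCommutative⟶ ACR.fromCommutativeRing R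
  fromℤ-morphism = record
    { ⟦_⟧ = fromℤ ; +-homo = fromℤ-+ ; *-homo = fromℤ-* ; -‿homo = fromℤ-neg
    ; 0-homo = refl ; 1-homo = refl }

  fromℤ-≟ : ∀ i j → Maybe (fromℤ i ≈ fromℤ j)
  fromℤ-≟ i j = map (λ i≡j → reflexive (≡.cong fromℤ i≡j)) (dec⇒weaklyDec ℤ._≟_ i j)

  open import Algebra.Solver.Ring ℤ.+-*-rawRing (ACR.fromCommutativeRing R) fromℤ-morphism fromℤ-≟ public

triangular-suc : ∀ k → (suc k ℕ.* k) / 2 ≡ (k ℕ.* (k ∸ 1)) / 2 +ℕ k
triangular-suc k = begin
  (suc k ℕ.* k) / 2                    ≡⟨ ≡.cong (_/ 2) (double k) ⟩
  (k ℕ.* (k ∸ 1) +ℕ k ℕ.* 2) / 2       ≡⟨ +-distrib-/-∣ʳ (k ℕ.* (k ∸ 1)) (divides-refl k) ⟩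
  (k ℕ.* (k ∸ 1)) / 2 +ℕ k ℕ.* 2 / 2   ≡⟨ ≡.cong ((k ℕ.* (k ∸ 1)) / 2 +ℕ_) (m*n/n≡m k 2) ⟩
  (k ℕ.* (k ∸ 1)) / 2 +ℕ k             ∎
  where
  open ≡.≡-Reasoning
  double : ∀ k → suc k ℕ.* k ≡ k ℕ.* (k ∸ 1) +ℕ k ℕ.* 2
  double zero    = ≡.refl
  double (suc k) = expand k
    where
    expand : ∀ k → suc (suc k) ℕ.* suc k ≡ suc k ℕ.* k +ℕ suc k ℕ.* 2
    expand = solve-∀

module QSeries {c ℓ : Level} (F : Field c ℓ) where
  open Field F hiding (zero)
  open FieldDefs F
  open CommutativeRingSolver commRing using (solve; _:=_; _:+_; _:*_; _:-_; :-_; con)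
  open import Algebra.Properties.CommutativeSemigroup +-commutativeSemigroup using () renaming (interchange to +-interchange)
  open import Algebra.Properties.CommutativeSemigroup *-commutativeSemigroup using () renaming (interchange to *-interchange)
  module ≈-Reasoning = SetoidReasoning setoid

  *-cancelˡ : ∀ {x y z} → ¬ (x ≈ 0#) → x * y ≈ x * z → y ≈ z
  *-cancelˡ {x} {y} {z} x≉0 xy≈xz = begin
    y               ≈⟨ *-identityˡ y ⟨
    1# * y          ≈⟨ *-congʳ x⁻¹x≈1 ⟨
    x ⁻¹ * x * y    ≈⟨ *-assoc _ _ _ ⟩
    x ⁻¹ * (x * y)  ≈⟨ *-congˡ xy≈xz ⟩
    x ⁻¹ * (x * z)  ≈⟨ *-assoc _ _ _ ⟨
    x ⁻¹ * x * z    ≈⟨ *-congʳ x⁻¹x≈1 ⟩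
    1# * z          ≈⟨ *-identityˡ z ⟩
    z               ∎
    where
    open ≈-Reasoning
    x⁻¹x≈1 : x ⁻¹ * x ≈ 1#
    x⁻¹x≈1 = trans (*-comm _ _) (⁻¹-inverse x x≉0)

  x*y≉0 : ∀ {x y} → ¬ (x ≈ 0#) → ¬ (y ≈ 0#) → ¬ (x * y ≈ 0#)
  x*y≉0 {x} {y} x≉0 y≉0 xy≈0 = y≉0 (*-cancelˡ x≉0 (trans xy≈0 (sym (zeroʳ x))))

  ⁻¹-unique : ∀ {x y} → x * y ≈ 1# → x ⁻¹ ≈ y
  ⁻¹-unique {x} {y} xy≈1 = *-cancelˡ x≉0 (trans (⁻¹-inverse x x≉0) (sym xy≈1))
    where
    x≉0 : ¬ (x ≈ 0#)
    x≉0 x≈0 = 1≉0 (trans (sym xy≈1) (trans (*-congʳ x≈0) (zeroˡ y)))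

  ⁻¹-distrib-* : ∀ {x y} → ¬ (x ≈ 0#) → ¬ (y ≈ 0#) → (x * y) ⁻¹ ≈ x ⁻¹ * y ⁻¹
  ⁻¹-distrib-* {x} {y} x≉0 y≉0 = ⁻¹-unique (begin
    x * y * (x ⁻¹ * y ⁻¹)      ≈⟨ *-interchange x y (x ⁻¹) (y ⁻¹) ⟩
    x * x ⁻¹ * (y * y ⁻¹)      ≈⟨ *-cong (⁻¹-inverse x x≉0) (⁻¹-inverse y y≉0) ⟩
    1# * 1#                    ≈⟨ *-identityˡ 1# ⟩
    1#                         ∎)
    where open ≈-Reasoning

  ÷-1# : ∀ x → x ÷ 1# ≈ x
  ÷-1# x = trans (*-congˡ (⁻¹-unique (*-identityˡ 1#))) (*-identityʳ x)

  ÷-cross : ∀ {x y z w} → ¬ (y ≈ 0#) → ¬ (w ≈ 0#) → x * y ≈ z * w → x ÷ w ≈ z ÷ y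
  ÷-cross {x} {y} {z} {w} y≉0 w≉0 xy≈zw = begin
    x * w ⁻¹                 ≈⟨ *-identityʳ _ ⟨
    x * w ⁻¹ * 1#            ≈⟨ *-congˡ (⁻¹-inverse y y≉0) ⟨
    x * w ⁻¹ * (y * y ⁻¹)    ≈⟨ solve 4 (λ x w′ y y′ → x :* w′ :* (y :* y′) := x :* y :* (w′ :* y′)) refl x (w ⁻¹) y (y ⁻¹) ⟩
    x * y * (w ⁻¹ * y ⁻¹)    ≈⟨ *-congʳ xy≈zw ⟩
    z * w * (w ⁻¹ * y ⁻¹)    ≈⟨ solve 4 (λ z w w′ y′ → z :* w :* (w′ :* y′) := z :* y′ :* (w :* w′)) refl z w (w ⁻¹) (y ⁻¹) ⟩
    z * y ⁻¹ * (w * w ⁻¹)    ≈⟨ *-congˡ (⁻¹-inverse w w≉0) ⟩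
    z * y ⁻¹ * 1#            ≈⟨ *-identityʳ _ ⟩
    z * y ⁻¹                 ∎
    where open ≈-Reasoning

  pow-cong : ∀ {x y} n → x ≈ y → pow x n ≈ pow y n
  pow-cong zero    x≈y = refl
  pow-cong (suc n) x≈y = *-cong x≈y (pow-cong n x≈y)

  pow-+ : ∀ x m n → pow x (m +ℕ n) ≈ pow x m * pow x n
  pow-+ x zero    n = sym (*-identityˡ _)
  pow-+ x (suc m) n = trans (*-congˡ (pow-+ x m n)) (sym (*-assoc _ _ _))

  pow-distrib-* : ∀ x y n → pow (x * y) n ≈ pow x n * pow y n
  pow-distrib-* x y zero    = sym (*-identityˡ 1#)
  pow-distrib-* x y (suc n) = trans (*-congˡ (pow-distrib-* x y n)) (*-interchange x y (pow x n) (pow y n))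

  pow-1# : ∀ n → pow 1# n ≈ 1#
  pow-1# zero    = refl
  pow-1# (suc n) = trans (*-identityˡ _) (pow-1# n)

  pow-inverse : ∀ {x y} n → x * y ≈ 1# → pow x n * pow y n ≈ 1#
  pow-inverse {x} {y} n xy≈1 = trans (sym (pow-distrib-* x y n)) (trans (pow-cong n xy≈1) (pow-1# n))

  -- Agreement of the coefficients of u^0, …, u^N: the series identities below hold only in this
  -- sense, because (q;q)_k is invertible only for k ≤ N.
  infix 4 _≈[≤_]_
  _≈[≤_]_ : Series → ℕ → Series → Set ℓ
  f ≈[≤ N ] g = ∀ {k} → k ≤ N → f k ≈ g k

  ≈[≤]-setoid : ℕ → Setoid c ℓ
  ≈[≤]-setoid N = record
    { Carrier       = Series
    ; _≈_           = _≈[≤ N ]_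
    ; isEquivalence = record
      { refl  = λ _ → refl
      ; sym   = λ f≈g k≤N → sym (f≈g k≤N)
      ; trans = λ f≈g g≈h k≤N → trans (f≈g k≤N) (g≈h k≤N)
      }
    }

  module ≈[≤]-Reasoning (N : ℕ) = SetoidReasoning (≈[≤]-setoid N)

  pointwise : ∀ {N f g} → (∀ k → f k ≈ g k) → f ≈[≤ N ] g
  pointwise f≗g {k} _ = f≗g k

  ≈[≤]-weaken : ∀ {k N f g} → k ≤ N → f ≈[≤ N ] g → f ≈[≤ k ] g
  ≈[≤]-weaken k≤N f≈g j≤k = f≈g (ℕₚ.≤-trans j≤k k≤N)

  sumTo-cong : ∀ N {f g} → f ≈[≤ N ] g → sumTo N f ≈ sumTo N g
  sumTo-cong zero    f≈g = f≈g ℕ.z≤n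
  sumTo-cong (suc N) f≈g = +-cong (sumTo-cong N (≈[≤]-weaken (ℕₚ.n≤1+n N) f≈g)) (f≈g ℕₚ.≤-refl)

  sumTo-+ : ∀ N f g → sumTo N (λ j → f j + g j) ≈ sumTo N f + sumTo N g
  sumTo-+ zero    f g = refl
  sumTo-+ (suc N) f g = trans (+-congʳ (sumTo-+ N f g)) (+-interchange _ _ _ _)

  sumTo-*ˡ : ∀ N x f → sumTo N (λ j → x * f j) ≈ x * sumTo N f
  sumTo-*ˡ zero    x f = refl
  sumTo-*ˡ (suc N) x f = trans (+-congʳ (sumTo-*ˡ N x f)) (sym (distribˡ _ _ _))

  sumTo-suc : ∀ N f → sumTo (suc N) f ≈ f 0 + sumTo N (λ j → f (suc j))
  sumTo-suc zero    f = refl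
  sumTo-suc (suc N) f = trans (+-congʳ (sumTo-suc N f)) (+-assoc _ _ _)

  sumTo-reverse : ∀ N f → sumTo N f ≈ sumTo N (λ j → f (N ∸ j))
  sumTo-reverse zero    f = refl
  sumTo-reverse (suc N) f = begin
    sumTo N f + f (suc N)                      ≈⟨ +-congʳ (sumTo-reverse N f) ⟩
    sumTo N (λ j → f (N ∸ j)) + f (suc N)      ≈⟨ +-comm _ _ ⟩
    f (suc N) + sumTo N (λ j → f (N ∸ j))      ≈⟨ sumTo-suc N (λ j → f (suc N ∸ j)) ⟨
    sumTo (suc N) (λ j → f (suc N ∸ j))        ∎
    where open ≈-Reasoning

  tail : Series → Series
  tail f k = f (suc k)

  ⊛-suc : ∀ f g k → (f ⊛ g) (suc k) ≈ f 0 * g (suc k) + (tail f ⊛ g) k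
  ⊛-suc f g k = sumTo-suc k (λ j → f j * g (suc k ∸ j))

  ⊛-cong-at : ∀ k {f f′ g g′} → f ≈[≤ k ] f′ → g ≈[≤ k ] g′ → (f ⊛ g) k ≈ (f′ ⊛ g′) k
  ⊛-cong-at k f≈f′ g≈g′ = sumTo-cong k (λ {j} j≤k → *-cong (f≈f′ j≤k) (g≈g′ (ℕₚ.m∸n≤m k j)))

  ⊛-cong : ∀ {N f f′ g g′} → f ≈[≤ N ] f′ → g ≈[≤ N ] g′ → f ⊛ g ≈[≤ N ] f′ ⊛ g′
  ⊛-cong f≈f′ g≈g′ {k} k≤N = ⊛-cong-at k (≈[≤]-weaken k≤N f≈f′) (≈[≤]-weaken k≤N g≈g′)

  ⊛-congˡ : ∀ {N} f {g g′} → g ≈[≤ N ] g′ → f ⊛ g ≈[≤ N ] f ⊛ g′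
  ⊛-congˡ f g≈g′ = ⊛-cong {f = f} (λ _ → refl) g≈g′

  ⊛-congʳ : ∀ {N} h {f f′} → f ≈[≤ N ] f′ → f ⊛ h ≈[≤ N ] f′ ⊛ h
  ⊛-congʳ h f≈f′ = ⊛-cong {g = h} f≈f′ (λ _ → refl)

  ⊛-linearˡ : ∀ x u v h k → ((λ j → x * u j + v j) ⊛ h) k ≈ x * (u ⊛ h) k + (v ⊛ h) k
  ⊛-linearˡ x u v h k = begin
    sumTo k (λ j → (x * u j + v j) * h (k ∸ j))
      ≈⟨ sumTo-cong k (λ _ → trans (distribʳ _ _ _) (+-congʳ (*-assoc _ _ _))) ⟩
    sumTo k (λ j → x * (u j * h (k ∸ j)) + v j * h (k ∸ j))
      ≈⟨ sumTo-+ k _ _ ⟩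
    sumTo k (λ j → x * (u j * h (k ∸ j))) + (v ⊛ h) k
      ≈⟨ +-congʳ (sumTo-*ˡ k x _) ⟩
    x * (u ⊛ h) k + (v ⊛ h) k ∎
    where open ≈-Reasoning

  ⊛-assoc : ∀ f g h k → ((f ⊛ g) ⊛ h) k ≈ (f ⊛ (g ⊛ h)) k
  ⊛-assoc f g h zero    = *-assoc _ _ _
  ⊛-assoc f g h (suc k) = begin
    ((f ⊛ g) ⊛ h) (suc k)
      ≈⟨ ⊛-suc (f ⊛ g) h k ⟩
    f 0 * g 0 * h (suc k) + (tail (f ⊛ g) ⊛ h) k
      ≈⟨ +-congˡ (⊛-cong-at k {g = h} {h} (λ {j} _ → ⊛-suc f g j) (λ _ → refl)) ⟩
    f 0 * g 0 * h (suc k) + ((λ j → f 0 * tail g j + (tail f ⊛ g) j) ⊛ h) k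
      ≈⟨ +-congˡ (⊛-linearˡ (f 0) (tail g) (tail f ⊛ g) h k) ⟩
    f 0 * g 0 * h (suc k) + (f 0 * (tail g ⊛ h) k + ((tail f ⊛ g) ⊛ h) k)
      ≈⟨ +-congˡ (+-congˡ (⊛-assoc (tail f) g h k)) ⟩
    f 0 * g 0 * h (suc k) + (f 0 * (tail g ⊛ h) k + (tail f ⊛ (g ⊛ h)) k)
      ≈⟨ solve 5 (λ a b c x y → a :* b :* c :+ (a :* x :+ y) := a :* (b :* c :+ x) :+ y) refl _ _ _ _ _ ⟩
    f 0 * (g 0 * h (suc k) + (tail g ⊛ h) k) + (tail f ⊛ (g ⊛ h)) k
      ≈⟨ +-congʳ (*-congˡ (⊛-suc g h k)) ⟨
    f 0 * (g ⊛ h) (suc k) + (tail f ⊛ (g ⊛ h)) k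
      ≈⟨ ⊛-suc f (g ⊛ h) k ⟨
    (f ⊛ (g ⊛ h)) (suc k) ∎
    where open ≈-Reasoning

  ⊛-comm : ∀ f g k → (f ⊛ g) k ≈ (g ⊛ f) k
  ⊛-comm f g k = trans (sumTo-reverse k _) (sumTo-cong k (λ {j} j≤k →
    trans (*-comm _ _) (*-congʳ (reflexive (≡.cong g (ℕₚ.m∸[m∸n]≡n j≤k))))))

  ⊛-identityˡ : ∀ f k → (oneS ⊛ f) k ≈ f k
  ⊛-identityˡ f zero    = *-identityˡ _
  ⊛-identityˡ f (suc k) = begin
    (oneS ⊛ f) (suc k)                               ≈⟨ ⊛-suc oneS f k ⟩
    1# * f (suc k) + sumTo k (λ j → 0# * f (k ∸ j))  ≈⟨ +-cong (*-identityˡ _) (sumTo-*ˡ k 0# _) ⟩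
    f (suc k) + 0# * sumTo k (λ j → f (k ∸ j))       ≈⟨ +-congˡ (zeroˡ _) ⟩
    f (suc k) + 0#                                   ≈⟨ +-identityʳ _ ⟩
    f (suc k)                                        ∎
    where open ≈-Reasoning

  ⊛-interchange : ∀ {N} f g h e → (f ⊛ g) ⊛ (h ⊛ e) ≈[≤ N ] (f ⊛ h) ⊛ (g ⊛ e)
  ⊛-interchange {N} f g h e = begin
    (f ⊛ g) ⊛ (h ⊛ e)    ≈⟨ pointwise (⊛-assoc f g (h ⊛ e)) ⟩
    f ⊛ (g ⊛ (h ⊛ e))    ≈⟨ ⊛-congˡ f (pointwise (⊛-assoc g h e)) ⟨
    f ⊛ ((g ⊛ h) ⊛ e)    ≈⟨ ⊛-congˡ f (⊛-congʳ e (pointwise (⊛-comm g h))) ⟩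
    f ⊛ ((h ⊛ g) ⊛ e)    ≈⟨ ⊛-congˡ f (pointwise (⊛-assoc h g e)) ⟩
    f ⊛ (h ⊛ (g ⊛ e))    ≈⟨ pointwise (⊛-assoc f h (g ⊛ e)) ⟨
    (f ⊛ h) ⊛ (g ⊛ e)    ∎
    where open ≈[≤]-Reasoning N

  mulOneMinus : Carrier → Series → Series
  mulOneMinus γ f zero    = f zero
  mulOneMinus γ f (suc k) = f (suc k) - γ * f k

  dilate : Carrier → Series → Series
  dilate q f k = pow q k * f k

  mulOneMinus-cong : ∀ {N} γ {f g} → f ≈[≤ N ] g → mulOneMinus γ f ≈[≤ N ] mulOneMinus γ g
  mulOneMinus-cong γ f≈g {zero}  k≤N = f≈g k≤N
  mulOneMinus-cong γ f≈g {suc k} k<N = +-cong (f≈g k<N) (-‿cong (*-congˡ (f≈g (ℕₚ.<⇒≤ k<N))))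

  mulOneMinus-0# : ∀ f k → mulOneMinus 0# f k ≈ f k
  mulOneMinus-0# f zero    = refl
  mulOneMinus-0# f (suc k) = solve 2 (λ x y → y :- con (+ 0) :* x := y) refl (f k) (f (suc k))

  mulOneMinus-⊛ˡ : ∀ γ f g k → mulOneMinus γ (f ⊛ g) k ≈ (mulOneMinus γ f ⊛ g) k
  mulOneMinus-⊛ˡ γ f g zero    = refl
  mulOneMinus-⊛ˡ γ f g (suc k) = begin
    (f ⊛ g) (suc k) - γ * (f ⊛ g) k
      ≈⟨ +-congʳ (⊛-suc f g k) ⟩
    f 0 * g (suc k) + (tail f ⊛ g) k - γ * (f ⊛ g) k
      ≈⟨ solve 4 (λ a b γ c → a :+ b :- γ :* c := a :+ ((:- γ) :* c :+ b)) refl _ _ γ _ ⟩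
    f 0 * g (suc k) + (- γ * (f ⊛ g) k + (tail f ⊛ g) k)
      ≈⟨ +-congˡ (⊛-linearˡ (- γ) f (tail f) g k) ⟨
    f 0 * g (suc k) + ((λ j → - γ * f j + f (suc j)) ⊛ g) k
      ≈⟨ +-congˡ (⊛-cong-at k {g = g} {g} (λ {j} _ → solve 3 (λ γ x y → (:- γ) :* x :+ y := y :- γ :* x)
           refl γ (f j) (f (suc j))) (λ _ → refl)) ⟩
    f 0 * g (suc k) + (tail (mulOneMinus γ f) ⊛ g) k
      ≈⟨ ⊛-suc (mulOneMinus γ f) g k ⟨
    (mulOneMinus γ f ⊛ g) (suc k) ∎
    where open ≈-Reasoning

  mulOneMinus-⊛ʳ : ∀ γ f g k → mulOneMinus γ (f ⊛ g) k ≈ (f ⊛ mulOneMinus γ g) k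
  mulOneMinus-⊛ʳ γ f g k = begin
    mulOneMinus γ (f ⊛ g) k    ≈⟨ mulOneMinus-cong {k} γ (pointwise (⊛-comm f g)) ℕₚ.≤-refl ⟩
    mulOneMinus γ (g ⊛ f) k    ≈⟨ mulOneMinus-⊛ˡ γ g f k ⟩
    (mulOneMinus γ g ⊛ f) k    ≈⟨ ⊛-comm _ f k ⟩
    (f ⊛ mulOneMinus γ g) k    ∎
    where open ≈-Reasoning

  dilate-⊛ : ∀ q f g k → dilate q (f ⊛ g) k ≈ (dilate q f ⊛ dilate q g) k
  dilate-⊛ q f g k = trans (sym (sumTo-*ˡ k (pow q k) _)) (sumTo-cong k (λ {j} j≤k → begin
    pow q k * (f j * g (k ∸ j))
      ≈⟨ *-congʳ (reflexive (≡.cong (pow q) (≡.sym (ℕₚ.m+[n∸m]≡n j≤k)))) ⟩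
    pow q (j +ℕ (k ∸ j)) * (f j * g (k ∸ j))
      ≈⟨ *-congʳ (pow-+ q j (k ∸ j)) ⟩
    pow q j * pow q (k ∸ j) * (f j * g (k ∸ j))
      ≈⟨ *-interchange _ _ _ _ ⟩
    pow q j * f j * (pow q (k ∸ j) * g (k ∸ j)) ∎))
    where open ≈-Reasoning

  -- (1 - α u) f(u) = (1 - β u) f(q u) modulo u^(N+1)
  QDifference : Carrier → ℕ → Carrier → Carrier → Series → Set ℓ
  QDifference q N α β f = mulOneMinus α f ≈[≤ N ] mulOneMinus β (dilate q f)

  QRecurrence : Carrier → ℕ → Carrier → Carrier → Series → Set ℓ
  QRecurrence q N α β f = ∀ {k} → suc k ≤ N → (1# - q * pow q k) * f (suc k) ≈ (α - β * pow q k) * f k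

  qRecurrence⇒qDifference : ∀ {q N α β f} → QRecurrence q N α β f → QDifference q N α β f
  qRecurrence⇒qDifference {f = f} rec {zero} _ = sym (*-identityˡ (f 0))
  qRecurrence⇒qDifference {q} {α = α} {β} {f} rec {suc k} k<N = begin
    f (suc k) - α * f k
      ≈⟨ solve 4 (λ Q α x y → y :- α :* x := (con (+ 1) :- Q) :* y :+ Q :* y :- α :* x) refl (q * pow q k) α (f k) (f (suc k)) ⟩
    (1# - q * pow q k) * f (suc k) + q * pow q k * f (suc k) - α * f k
      ≈⟨ +-congʳ (+-congʳ (rec k<N)) ⟩
    (α - β * pow q k) * f k + q * pow q k * f (suc k) - α * f k
      ≈⟨ solve 6 (λ q qk α β x y → (α :- β :* qk) :* x :+ q :* qk :* y :- α :* x := q :* qk :* y :- β :* (qk :* x))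
           refl q (pow q k) α β (f k) (f (suc k)) ⟩
    q * pow q k * f (suc k) - β * (pow q k * f k) ∎
    where open ≈-Reasoning

  qDifference⇒qRecurrence : ∀ {q N α β f} → QDifference q N α β f → QRecurrence q N α β f
  qDifference⇒qRecurrence {q} {α = α} {β} {f} eq {k} k<N = begin
    (1# - q * pow q k) * f (suc k)
      ≈⟨ solve 4 (λ Q α x y → (con (+ 1) :- Q) :* y := (y :- α :* x) :- Q :* y :+ α :* x) refl (q * pow q k) α (f k) (f (suc k)) ⟩
    (f (suc k) - α * f k) - q * pow q k * f (suc k) + α * f k
      ≈⟨ +-congʳ (+-congʳ (eq k<N)) ⟩
    (q * pow q k * f (suc k) - β * (pow q k * f k)) - q * pow q k * f (suc k) + α * f k
      ≈⟨ solve 6 (λ q qk α β x y → (q :* qk :* y :- β :* (qk :* x)) :- q :* qk :* y :+ α :* x := (α :- β :* qk) :* x)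
           refl q (pow q k) α β (f k) (f (suc k)) ⟩
    (α - β * pow q k) * f k ∎
    where open ≈-Reasoning

  qDifference-unique : ∀ {q N α β f g} → (∀ {k} → suc k ≤ N → ¬ (1# - q * pow q k ≈ 0#)) →
                       QDifference q N α β f → QDifference q N α β g → f 0 ≈ g 0 → f ≈[≤ N ] g
  qDifference-unique nz f-eq g-eq f0≈g0 {zero} _ = f0≈g0
  qDifference-unique {q} {α = α} {β} {f} {g} nz f-eq g-eq f0≈g0 {suc k} k<N = *-cancelˡ (nz k<N) (begin
    (1# - q * pow q k) * f (suc k)  ≈⟨ qDifference⇒qRecurrence f-eq k<N ⟩
    (α - β * pow q k) * f k         ≈⟨ *-congˡ (qDifference-unique nz f-eq g-eq f0≈g0 (ℕₚ.<⇒≤ k<N)) ⟩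
    (α - β * pow q k) * g k         ≈⟨ qDifference⇒qRecurrence g-eq k<N ⟨
    (1# - q * pow q k) * g (suc k)  ∎)
    where open ≈-Reasoning

  qDifference-⊛ : ∀ {q N β γ f g} → QDifference q N 0# β f → QDifference q N γ 0# g → QDifference q N γ β (f ⊛ g)
  qDifference-⊛ {q} {N} {β} {γ} {f} {g} f-eq g-eq = begin
    mulOneMinus γ (f ⊛ g)                    ≈⟨ pointwise (mulOneMinus-⊛ʳ γ f g) ⟩
    f ⊛ mulOneMinus γ g                      ≈⟨ ⊛-congˡ f g-eq ⟩
    f ⊛ mulOneMinus 0# (dilate q g)          ≈⟨ ⊛-congˡ f (pointwise (mulOneMinus-0# (dilate q g))) ⟩
    f ⊛ dilate q g                           ≈⟨ ⊛-congʳ (dilate q g) (pointwise (mulOneMinus-0# f)) ⟨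
    mulOneMinus 0# f ⊛ dilate q g            ≈⟨ ⊛-congʳ (dilate q g) f-eq ⟩
    mulOneMinus β (dilate q f) ⊛ dilate q g  ≈⟨ pointwise (mulOneMinus-⊛ˡ β (dilate q f) (dilate q g)) ⟨
    mulOneMinus β (dilate q f ⊛ dilate q g)  ≈⟨ mulOneMinus-cong β (pointwise (dilate-⊛ q f g)) ⟨
    mulOneMinus β (dilate q (f ⊛ g))         ∎
    where open ≈[≤]-Reasoning N

  qBinomialSeries : Carrier → Carrier → Carrier → Series
  qBinomialSeries q c b k = qPoch c q k * pow b k ÷ qPoch q q k

  qPoch-cong : ∀ {c c′} q k → c ≈ c′ → qPoch c q k ≈ qPoch c′ q k
  qPoch-cong q zero    c≈c′ = refl
  qPoch-cong q (suc k) c≈c′ = *-cong (qPoch-cong q k c≈c′) (+-congˡ (-‿cong (*-congʳ c≈c′)))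

  qPoch-1#-suc : ∀ q k → qPoch 1# q (suc k) ≈ 0#
  qPoch-1#-suc q zero    = solve 0 (con (+ 1) :* (con (+ 1) :- con (+ 1) :* con (+ 1)) := con (+ 0)) refl
  qPoch-1#-suc q (suc k) = trans (*-congʳ (qPoch-1#-suc q k)) (zeroˡ _)

  qBinomialSeries-cong : ∀ {c c′ b b′} q → c ≈ c′ → b ≈ b′ → ∀ k → qBinomialSeries q c b k ≈ qBinomialSeries q c′ b′ k
  qBinomialSeries-cong q c≈c′ b≈b′ k = *-congʳ (*-cong (qPoch-cong q k c≈c′) (pow-cong k b≈b′))

  qBinomialSeries-1# : ∀ q b k → qBinomialSeries q 1# b k ≈ oneS k
  qBinomialSeries-1# q b zero    = trans (÷-1# _) (*-identityˡ 1#)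
  qBinomialSeries-1# q b (suc k) = trans (*-congʳ (trans (*-congʳ (qPoch-1#-suc q k)) (zeroˡ _))) (zeroˡ _)

  infProd-cong : ∀ {b b′} q → b ≈ b′ → ∀ k → infProd b q k ≈ infProd b′ q k
  infProd-cong q b≈b′ k = *-congʳ (*-congˡ (pow-cong k b≈b′))

  module QBinomial (q : Carrier) (N : ℕ) (qPoch-q≉0 : ∀ k → k ≤ N → ¬ (qPoch q q k ≈ 0#)) where

    1-q^[1+k]≉0 : ∀ {k} → suc k ≤ N → ¬ (1# - q * pow q k ≈ 0#)
    1-q^[1+k]≉0 {k} k<N ≈0 = qPoch-q≉0 (suc k) k<N (trans (*-congˡ ≈0) (zeroʳ _))

    *-÷-qPoch-suc : ∀ {k} → suc k ≤ N → ∀ x → (1# - q * pow q k) * (x ÷ qPoch q q (suc k)) ≈ x ÷ qPoch q q k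
    *-÷-qPoch-suc {k} k<N x = begin
      d * (x * (Q * d) ⁻¹)       ≈⟨ *-congˡ (*-congˡ (⁻¹-distrib-* (qPoch-q≉0 k (ℕₚ.<⇒≤ k<N)) (1-q^[1+k]≉0 k<N))) ⟩
      d * (x * (Q ⁻¹ * d ⁻¹))    ≈⟨ solve 4 (λ d x Q′ d′ → d :* (x :* (Q′ :* d′)) := x :* Q′ :* (d :* d′))
           refl d x (Q ⁻¹) (d ⁻¹) ⟩
      x * Q ⁻¹ * (d * d ⁻¹)      ≈⟨ *-congˡ (⁻¹-inverse d (1-q^[1+k]≉0 k<N)) ⟩
      x * Q ⁻¹ * 1#              ≈⟨ *-identityʳ _ ⟩
      x * Q ⁻¹                   ∎
      where
      open ≈-Reasoning
      d Q : Carrier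
      d = 1# - q * pow q k
      Q = qPoch q q k

    qBinomialSeries-qDifference : ∀ c b → QDifference q N b (c * b) (qBinomialSeries q c b)
    qBinomialSeries-qDifference c b = qRecurrence⇒qDifference λ {k} k<N → begin
      (1# - q * pow q k) * (qPoch c q k * (1# - c * pow q k) * (b * pow b k) ÷ qPoch q q (suc k))
        ≈⟨ *-÷-qPoch-suc k<N _ ⟩
      qPoch c q k * (1# - c * pow q k) * (b * pow b k) ÷ qPoch q q k
        ≈⟨ solve 6 (λ C c qk b B Q′ → C :* (con (+ 1) :- c :* qk) :* (b :* B) :* Q′ := (b :- c :* b :* qk) :* (C :* B :* Q′)) refl
             (qPoch c q k) c (pow q k) b (pow b k) (qPoch q q k ⁻¹) ⟩
      (b - c * b * pow q k) * qBinomialSeries q c b k ∎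
      where open ≈-Reasoning

    invInfProd-qDifference : ∀ b → QDifference q N b 0# (invInfProd b q)
    invInfProd-qDifference b = qRecurrence⇒qDifference λ {k} k<N → begin
      (1# - q * pow q k) * (b * pow b k ÷ qPoch q q (suc k))   ≈⟨ *-÷-qPoch-suc k<N _ ⟩
      b * pow b k ÷ qPoch q q k
        ≈⟨ solve 4 (λ qk b B Q′ → b :* B :* Q′ := (b :- con (+ 0) :* qk) :* (B :* Q′))
             refl (pow q k) b (pow b k) (qPoch q q k ⁻¹) ⟩
      (b - 0# * pow q k) * invInfProd b q k ∎
      where open ≈-Reasoning

    infProd-qDifference : ∀ b → QDifference q N 0# b (infProd b q)
    infProd-qDifference b = qRecurrence⇒qDifference λ {k} k<N → begin
      (1# - q * pow q k) * (- 1# * pow (- 1#) k * pow q ((suc k ℕ.* k) / 2) * (b * pow b k) ÷ qPoch q q (suc k))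
        ≈⟨ *-÷-qPoch-suc k<N _ ⟩
      - 1# * pow (- 1#) k * pow q ((suc k ℕ.* k) / 2) * (b * pow b k) ÷ qPoch q q k
        ≈⟨ *-congʳ (*-congʳ (*-congˡ (trans (reflexive (≡.cong (pow q) (triangular-suc k))) (pow-+ q ((k ℕ.* (k ∸ 1)) / 2) k)))) ⟩
      - 1# * pow (- 1#) k * (pow q ((k ℕ.* (k ∸ 1)) / 2) * pow q k) * (b * pow b k) ÷ qPoch q q k
        ≈⟨ solve 6 (λ s H qk b B Q′ → :- con (+ 1) :* s :* (H :* qk) :* (b :* B) :* Q′ := (con (+ 0) :- b :* qk) :* (s :* H :* B :* Q′)) refl
             (pow (- 1#) k) (pow q ((k ℕ.* (k ∸ 1)) / 2)) (pow q k) b (pow b k) (qPoch q q k ⁻¹) ⟩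
      (0# - b * pow q k) * infProd b q k ∎
      where open ≈-Reasoning

    -- The q-binomial theorem: both sides solve the q-difference equation with α = b, β = c b.
    infProd-⊛-invInfProd : ∀ c b → infProd (c * b) q ⊛ invInfProd b q ≈[≤ N ] qBinomialSeries q c b
    infProd-⊛-invInfProd c b =
      qDifference-unique 1-q^[1+k]≉0
        (qDifference-⊛ (infProd-qDifference (c * b)) (invInfProd-qDifference b))
        (qBinomialSeries-qDifference c b)
        (begin
          1# * 1# * 1# * 1# ⁻¹ * (1# * 1# ⁻¹)   ≈⟨ *-congʳ (÷-1# _) ⟩
          1# * 1# * 1# * (1# * 1# ⁻¹)          ≈⟨ solve 1 (λ u → con (+ 1) :* con (+ 1) :* con (+ 1) :* (con (+ 1) :* u)
                 := con (+ 1) :* con (+ 1) :* u)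
               refl (1# ⁻¹) ⟩
          1# * 1# * 1# ⁻¹                      ∎)
      where open ≈-Reasoning

    invInfProd-⊛-infProd : ∀ b → invInfProd b q ⊛ infProd b q ≈[≤ N ] oneS
    invInfProd-⊛-infProd b = begin
      invInfProd b q ⊛ infProd b q           ≈⟨ pointwise (⊛-comm (invInfProd b q) (infProd b q)) ⟩
      infProd b q ⊛ invInfProd b q           ≈⟨ ⊛-congʳ (invInfProd b q) (pointwise (infProd-cong q (*-identityˡ b))) ⟨
      infProd (1# * b) q ⊛ invInfProd b q    ≈⟨ infProd-⊛-invInfProd 1# b ⟩
      qBinomialSeries q 1# b                 ≈⟨ pointwise (qBinomialSeries-1# q b) ⟩
      oneS                                   ∎
      where open ≈[≤]-Reasoning N

    -- (c d b u;q)_∞ / (b u;q)_∞ telescopes through (d b u;q)_∞.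
    qBinomialSeries-⊛ : ∀ c d b → qBinomialSeries q c (d * b) ⊛ qBinomialSeries q d b ≈[≤ N ] qBinomialSeries q (c * d) b
    qBinomialSeries-⊛ c d b = begin
      qBinomialSeries q c (d * b) ⊛ qBinomialSeries q d b
        ≈⟨ ⊛-cong (infProd-⊛-invInfProd c (d * b)) (infProd-⊛-invInfProd d b) ⟨
      (E (c * (d * b)) ⊛ I (d * b)) ⊛ (E (d * b) ⊛ I b)
        ≈⟨ pointwise (⊛-assoc (E (c * (d * b))) (I (d * b)) (E (d * b) ⊛ I b)) ⟩
      E (c * (d * b)) ⊛ (I (d * b) ⊛ (E (d * b) ⊛ I b))
        ≈⟨ ⊛-congˡ (E (c * (d * b))) (pointwise (⊛-assoc (I (d * b)) (E (d * b)) (I b))) ⟨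
      E (c * (d * b)) ⊛ ((I (d * b) ⊛ E (d * b)) ⊛ I b)
        ≈⟨ ⊛-congˡ (E (c * (d * b))) (⊛-congʳ (I b) (invInfProd-⊛-infProd (d * b))) ⟩
      E (c * (d * b)) ⊛ (oneS ⊛ I b)
        ≈⟨ ⊛-congˡ (E (c * (d * b))) (pointwise (⊛-identityˡ (I b))) ⟩
      E (c * (d * b)) ⊛ I b
        ≈⟨ ⊛-congʳ (I b) (pointwise (infProd-cong q (*-assoc c d b))) ⟨
      E (c * d * b) ⊛ I b
        ≈⟨ infProd-⊛-invInfProd (c * d) b ⟩
      qBinomialSeries q (c * d) b ∎
      where
      open ≈[≤]-Reasoning N
      E I : Carrier → Series
      E b = infProd b q
      I b = invInfProd b q

    factor-split : ∀ t x → factor q t x ≈[≤ N ] qBinomialSeries q t x ⊛ qBinomialSeries q t (x ⁻¹)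
    factor-split t x = begin
      ((infProd (t * x) q ⊛ invInfProd x q) ⊛ infProd (t * x ⁻¹) q) ⊛ invInfProd (x ⁻¹) q
        ≈⟨ ⊛-congʳ (invInfProd (x ⁻¹) q) (⊛-congʳ (infProd (t * x ⁻¹) q) (infProd-⊛-invInfProd t x)) ⟩
      (qBinomialSeries q t x ⊛ infProd (t * x ⁻¹) q) ⊛ invInfProd (x ⁻¹) q
        ≈⟨ pointwise (⊛-assoc (qBinomialSeries q t x) (infProd (t * x ⁻¹) q) (invInfProd (x ⁻¹) q)) ⟩
      qBinomialSeries q t x ⊛ (infProd (t * x ⁻¹) q ⊛ invInfProd (x ⁻¹) q)
        ≈⟨ ⊛-congˡ (qBinomialSeries q t x) (infProd-⊛-invInfProd t (x ⁻¹)) ⟩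
      qBinomialSeries q t x ⊛ qBinomialSeries q t (x ⁻¹) ∎
      where open ≈[≤]-Reasoning N

    geomPoint-product : ∀ {t a} → ¬ (t ≈ 0#) → ¬ (a ≈ 0#) → ∀ n →
      foldr (λ x s → factor q t x ⊛ s) oneS (geomPoint n t a)
        ≈[≤ N ] qBinomialSeries q (pow t n) a ⊛ qBinomialSeries q (pow t n) (t * pow (t ⁻¹) n * a ⁻¹)
    geomPoint-product {t} {a} _ _ zero = begin
      oneS                                                   ≈⟨ pointwise (⊛-identityˡ oneS) ⟨
      oneS ⊛ oneS                                            ≈⟨ ⊛-cong (pointwise (qBinomialSeries-1# q a)) (pointwise (qBinomialSeries-1# q (t * 1# * a ⁻¹))) ⟨
      qBinomialSeries q 1# a ⊛ qBinomialSeries q 1# (t * 1# * a ⁻¹) ∎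
      where open ≈[≤]-Reasoning N
    geomPoint-product {t} {a} t≉0 a≉0 (suc n) = begin
      factor q t x ⊛ foldr (λ x s → factor q t x ⊛ s) oneS (geomPoint n t a)
        ≈⟨ ⊛-cong (factor-split t x) (geomPoint-product t≉0 a≉0 n) ⟩
      (P t x ⊛ P t (x ⁻¹)) ⊛ (P T a ⊛ P T (t * T′ * a ⁻¹))
        ≈⟨ ⊛-interchange (P t x) (P t (x ⁻¹)) (P T a) (P T (t * T′ * a ⁻¹)) ⟩
      (P t x ⊛ P T a) ⊛ (P t (x ⁻¹) ⊛ P T (t * T′ * a ⁻¹))
        ≈⟨ ⊛-congˡ (P t x ⊛ P T a) (pointwise (⊛-comm (P t (x ⁻¹)) (P T (t * T′ * a ⁻¹)))) ⟩
      (P t x ⊛ P T a) ⊛ (P T (t * T′ * a ⁻¹) ⊛ P t (x ⁻¹))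
        ≈⟨ ⊛-congˡ (P t x ⊛ P T a) (⊛-congʳ (P t (x ⁻¹)) (pointwise (qBinomialSeries-cong {c = T} q refl t*T′*a⁻¹≈t*x⁻¹))) ⟩
      (P t (T * a) ⊛ P T a) ⊛ (P T (t * x ⁻¹) ⊛ P t (x ⁻¹))
        ≈⟨ ⊛-cong (qBinomialSeries-⊛ t T a) (qBinomialSeries-⊛ T t (x ⁻¹)) ⟩
      P (t * T) a ⊛ P (T * t) (x ⁻¹)
        ≈⟨ ⊛-congˡ (P (t * T) a) (pointwise (qBinomialSeries-cong q (*-comm T t) x⁻¹≈t*[t⁻¹*T′]*a⁻¹)) ⟩
      P (t * T) a ⊛ P (t * T) (t * (t ⁻¹ * T′) * a ⁻¹) ∎
      where
      open ≈[≤]-Reasoning N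
      P : Carrier → Carrier → Series
      P = qBinomialSeries q
      T T′ x : Carrier
      T  = pow t n
      T′ = pow (t ⁻¹) n
      x  = T * a
      x⁻¹≈T′*a⁻¹ : x ⁻¹ ≈ T′ * a ⁻¹
      x⁻¹≈T′*a⁻¹ = ⁻¹-unique (trans (*-interchange T a T′ (a ⁻¹))
        (trans (*-cong (pow-inverse n (⁻¹-inverse t t≉0)) (⁻¹-inverse a a≉0)) (*-identityˡ 1#)))
      t*T′*a⁻¹≈t*x⁻¹ : t * T′ * a ⁻¹ ≈ t * x ⁻¹
      t*T′*a⁻¹≈t*x⁻¹ = trans (*-assoc t T′ (a ⁻¹)) (*-congˡ (sym x⁻¹≈T′*a⁻¹))
      x⁻¹≈t*[t⁻¹*T′]*a⁻¹ : x ⁻¹ ≈ t * (t ⁻¹ * T′) * a ⁻¹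
      x⁻¹≈t*[t⁻¹*T′]*a⁻¹ = trans x⁻¹≈T′*a⁻¹ (*-congʳ (trans (sym (*-identityˡ T′))
        (trans (*-congʳ (sym (⁻¹-inverse t t≉0))) (*-assoc t (t ⁻¹) T′))))

  q*q′^N*q^i≈q′^m : ∀ {q q′} → q * q′ ≈ 1# → ∀ {N} i m → suc m +ℕ i ≡ N → q * (pow q′ N * pow q i) ≈ pow q′ m
  q*q′^N*q^i≈q′^m {q} {q′} qq′≈1 i m ≡.refl = begin
    q * (q′ * pow q′ (m +ℕ i) * pow q i)            ≈⟨ *-congˡ (*-congʳ (*-congˡ (pow-+ q′ m i))) ⟩
    q * (q′ * (pow q′ m * pow q′ i) * pow q i)      ≈⟨ solve 5 (λ q q′ w v u → q :* (q′ :* (w :* v) :* u) := q :* q′ :* (u :* v) :* w)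
         refl q q′ (pow q′ m) (pow q′ i) (pow q i) ⟩
    q * q′ * (pow q i * pow q′ i) * pow q′ m        ≈⟨ *-congʳ (*-cong qq′≈1 (pow-inverse i qq′≈1)) ⟩
    1# * 1# * pow q′ m                              ≈⟨ trans (*-congʳ (*-identityˡ 1#)) (*-identityˡ _) ⟩
    pow q′ m                                        ∎
    where open ≈-Reasoning

  -- (x;q)_(N-i) / (q;q)_(N-i) = (x;q)_N / (q;q)_N · (q^-N;q)_i / (q^(1-N)/x;q)_i · (q/x)^i, cross-multiplied
  -- so that no factor (1 - x q^j) has to be inverted.
  qPoch-reversal : ∀ {q q′ x x′} → q * q′ ≈ 1# → x * x′ ≈ 1# → ∀ {N} i m → m +ℕ i ≡ N →
    qPoch x q m * (qPoch q q N * qPoch (x′ * (q * pow q′ N)) q i)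
      ≈ qPoch x q N * qPoch (pow q′ N) q i * pow (q * x′) i * qPoch q q m
  qPoch-reversal {q} {x = x} _ _ zero m m+0≡N with ≡.trans (≡.sym (ℕₚ.+-identityʳ m)) m+0≡N
  ... | ≡.refl = solve 2 (λ X Q → X :* (Q :* con (+ 1)) := X :* con (+ 1) :* con (+ 1) :* Q) refl (qPoch x q m) (qPoch q q m)
  qPoch-reversal {q} {q′} {x} {x′} qq′≈1 xx′≈1 {N} (suc i) m m+1+i≡N = begin
    X m * (Q N * (B i * (1# - b * pow q i)))
      ≈⟨ *-congˡ (*-congˡ (*-congˡ B-step)) ⟩
    X m * (Q N * (B i * ((1# - x * pow q m) * - (x′ * w))))
      ≈⟨ solve 5 (λ A C D E u → A :* (C :* (D :* (E :* u))) := A :* E :* (C :* D) :* u)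
           refl (X m) (Q N) (B i) (1# - x * pow q m) (- (x′ * w)) ⟩
    X (suc m) * (Q N * B i) * - (x′ * w)
      ≈⟨ *-congʳ (qPoch-reversal qq′≈1 xx′≈1 i (suc m) 1+m+i≡N) ⟩
    X N * R i * Y * Q (suc m) * - (x′ * w)
      ≈⟨ solve 6 (λ A C D E G u → A :* C :* D :* (E :* G) :* u := A :* C :* D :* E :* (G :* u))
           refl (X N) (R i) Y (Q m) (1# - q * pow q m) (- (x′ * w)) ⟩
    X N * R i * Y * Q m * ((1# - q * pow q m) * - (x′ * w))
      ≈⟨ *-congˡ R-step ⟩
    X N * R i * Y * Q m * ((1# - pow q′ N * pow q i) * (q * x′))
      ≈⟨ solve 7 (λ A C D E G h k → A :* C :* D :* E :* (G :* (h :* k)) := A :* (C :* G) :* (h :* k :* D) :* E)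
           refl (X N) (R i) Y (Q m) (1# - pow q′ N * pow q i) q x′ ⟩
    X N * R (suc i) * pow (q * x′) (suc i) * Q m ∎
    where
    open ≈-Reasoning
    X Q R B : ℕ → Carrier
    X k = qPoch x q k
    Q k = qPoch q q k
    R k = qPoch (pow q′ N) q k
    B k = qPoch (x′ * (q * pow q′ N)) q k
    b w Y : Carrier
    b = x′ * (q * pow q′ N)
    w = pow q′ m
    Y = pow (q * x′) i
    1+m+i≡N : suc m +ℕ i ≡ N
    1+m+i≡N = ≡.trans (≡.sym (ℕₚ.+-suc m i)) m+1+i≡N
    q*q′^N*q^i≈w : q * (pow q′ N * pow q i) ≈ w
    q*q′^N*q^i≈w = q*q′^N*q^i≈q′^m qq′≈1 i m 1+m+i≡N
    q^m*w≈1 : pow q m * w ≈ 1#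
    q^m*w≈1 = pow-inverse m qq′≈1
    B-step : 1# - b * pow q i ≈ (1# - x * pow q m) * - (x′ * w)
    B-step = begin
      1# - x′ * (q * pow q′ N) * pow q i        ≈⟨ solve 4 (λ x′ q Q u → con (+ 1) :- x′ :* (q :* Q) :* u := con (+ 1) :- x′ :* (q :* (Q :* u)))
           refl x′ q (pow q′ N) (pow q i) ⟩
      1# - x′ * (q * (pow q′ N * pow q i))      ≈⟨ +-congˡ (-‿cong (*-congˡ q*q′^N*q^i≈w)) ⟩
      1# - x′ * w                               ≈⟨ +-congʳ (trans (*-cong xx′≈1 q^m*w≈1) (*-identityˡ 1#)) ⟨
      x * x′ * (pow q m * w) - x′ * w            ≈⟨ solve 4 (λ x x′ u w → x :* x′ :* (u :* w) :- x′ :* w := (con (+ 1) :- x :* u) :* (:- (x′ :* w)))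
           refl x x′ (pow q m) w ⟩
      (1# - x * pow q m) * - (x′ * w)           ∎
    R-step : (1# - q * pow q m) * - (x′ * w) ≈ (1# - pow q′ N * pow q i) * (q * x′)
    R-step = begin
      (1# - q * pow q m) * - (x′ * w)            ≈⟨ solve 4 (λ q x′ u w → (con (+ 1) :- q :* u) :* (:- (x′ :* w)) := q :* x′ :* (u :* w) :- x′ :* w)
           refl q x′ (pow q m) w ⟩
      q * x′ * (pow q m * w) - x′ * w            ≈⟨ +-congʳ (trans (*-congˡ q^m*w≈1) (*-identityʳ _)) ⟩
      q * x′ - x′ * w                            ≈⟨ +-congˡ (-‿cong (*-congˡ q*q′^N*q^i≈w)) ⟨
      q * x′ - x′ * (q * (pow q′ N * pow q i))   ≈⟨ solve 4 (λ q x′ Q u → q :* x′ :- x′ :* (q :* (Q :* u)) := (con (+ 1) :- Q :* u) :* (q :* x′))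
           refl q x′ (pow q′ N) (pow q i) ⟩
      (1# - pow q′ N * pow q i) * (q * x′)      ∎

  qBinomialSeries-⊛-phi21 : ∀ {q q′ T T′ a b z N} → q * q′ ≈ 1# → T * T′ ≈ 1# → a * z ≈ q * T′ * b →
    (∀ k → k ≤ N → ¬ (qPoch q q k ≈ 0#)) → (∀ k → k ≤ N → ¬ (qPoch (T′ * (q * pow q′ N)) q k ≈ 0#)) →
    (qBinomialSeries q T a ⊛ qBinomialSeries q T b) N
      ≈ pow a N * (qPoch T q N ÷ qPoch q q N) * phi21 N (pow q′ N) T (T′ * (q * pow q′ N)) q z
  qBinomialSeries-⊛-phi21 {q} {q′} {T} {T′} {a} {b} {z} {N} qq′≈1 TT′≈1 az≈qT′b Q≉0 B≉0 = begin
    (qBinomialSeries q T a ⊛ qBinomialSeries q T b) N  ≈⟨ ⊛-comm _ (qBinomialSeries q T b) N ⟩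
    (qBinomialSeries q T b ⊛ qBinomialSeries q T a) N  ≈⟨ sumTo-cong N (λ {i} i≤N → term i (N ∸ i) (ℕₚ.m∸n+n≡m i≤N)) ⟩
    sumTo N (λ i → C * g i)                            ≈⟨ sumTo-*ˡ N C g ⟩
    C * sumTo N g                                      ∎
    where
    open ≈-Reasoning
    X Q R B : ℕ → Carrier
    X k = qPoch T q k
    Q k = qPoch q q k
    R k = qPoch (pow q′ N) q k
    B k = qPoch (T′ * (q * pow q′ N)) q k
    C : Carrier
    C = pow a N * (X N ÷ Q N)
    g : ℕ → Carrier
    g i = (R i * X i ÷ B i) * (pow z i ÷ Q i)
    term : ∀ i m → m +ℕ i ≡ N → qBinomialSeries q T b i * qBinomialSeries q T a m ≈ C * g i
    term i m m+i≡N = begin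
      X i * pow b i * Q i ⁻¹ * (X m * pow a m * Q m ⁻¹)
        ≈⟨ solve 6 (λ Xi bi Qi′ Xm am Qm′ → Xi :* bi :* Qi′ :* (Xm :* am :* Qm′) := Xm :* Qm′ :* (Xi :* bi :* Qi′ :* am))
             refl (X i) (pow b i) (Q i ⁻¹) (X m) (pow a m) (Q m ⁻¹) ⟩
      X m ÷ Q m * (X i * pow b i * Q i ⁻¹ * pow a m)
        ≈⟨ *-congʳ (÷-cross (x*y≉0 (Q≉0 N ℕₚ.≤-refl) (B≉0 i i≤N)) (Q≉0 m m≤N) (qPoch-reversal qq′≈1 TT′≈1 i m m+i≡N)) ⟩
      X N * R i * pow (q * T′) i * (Q N * B i) ⁻¹ * (X i * pow b i * Q i ⁻¹ * pow a m)
        ≈⟨ *-congʳ (*-congˡ (⁻¹-distrib-* (Q≉0 N ℕₚ.≤-refl) (B≉0 i i≤N))) ⟩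
      X N * R i * pow (q * T′) i * (Q N ⁻¹ * B i ⁻¹) * (X i * pow b i * Q i ⁻¹ * pow a m)
        ≈⟨ solve 9 (λ XN Ri Y QN′ Bi′ Xi bi Qi′ am → XN :* Ri :* Y :* (QN′ :* Bi′) :* (Xi :* bi :* Qi′ :* am)
               := am :* (XN :* QN′) :* (Ri :* Xi :* Bi′) :* (Y :* bi) :* Qi′) refl
             (X N) (R i) (pow (q * T′) i) (Q N ⁻¹) (B i ⁻¹) (X i) (pow b i) (Q i ⁻¹) (pow a m) ⟩
      pow a m * (X N ÷ Q N) * (R i * X i ÷ B i) * (pow (q * T′) i * pow b i) * Q i ⁻¹
        ≈⟨ *-congʳ (*-congˡ [qT′]^i*b^i≈a^i*z^i) ⟩
      pow a m * (X N ÷ Q N) * (R i * X i ÷ B i) * (pow a i * pow z i) * Q i ⁻¹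
        ≈⟨ solve 6 (λ am C′ G ai zi Qi′ → am :* C′ :* G :* (ai :* zi) :* Qi′ := am :* ai :* C′ :* (G :* (zi :* Qi′))) refl
             (pow a m) (X N ÷ Q N) (R i * X i ÷ B i) (pow a i) (pow z i) (Q i ⁻¹) ⟩
      pow a m * pow a i * (X N ÷ Q N) * g i
        ≈⟨ *-congʳ (*-congʳ (trans (sym (pow-+ a m i)) (reflexive (≡.cong (pow a) m+i≡N)))) ⟩
      C * g i ∎
      where
      m≤N : m ≤ N
      m≤N = ≡.subst (m ≤_) m+i≡N (ℕₚ.m≤m+n m i)
      i≤N : i ≤ N
      i≤N = ≡.subst (i ≤_) m+i≡N (ℕₚ.m≤n+m i m)
      [qT′]^i*b^i≈a^i*z^i : pow (q * T′) i * pow b i ≈ pow a i * pow z i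
      [qT′]^i*b^i≈a^i*z^i = begin
        pow (q * T′) i * pow b i  ≈⟨ pow-distrib-* (q * T′) b i ⟨
        pow (q * T′ * b) i        ≈⟨ pow-cong i az≈qT′b ⟨
        pow (a * z) i             ≈⟨ pow-distrib-* a z i ⟩
        pow a i * pow z i         ∎

  rescale-argument : ∀ {a} → ¬ (a ≈ 0#) → ∀ q t n →
    a * (q * t * pow (t ⁻¹) (n +ℕ n) ÷ pow a 2) ≈ q * pow (t ⁻¹) n * (t * pow (t ⁻¹) n * a ⁻¹)
  rescale-argument {a} a≉0 q t n = begin
    a * (q * t * pow (t ⁻¹) (n +ℕ n) * pow a 2 ⁻¹)
      ≈⟨ *-congˡ (*-cong (*-congˡ (pow-+ (t ⁻¹) n n)) [a²]⁻¹≈a⁻¹*a⁻¹) ⟩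
    a * (q * t * (T′ * T′) * (a ⁻¹ * a ⁻¹))
      ≈⟨ solve 5 (λ a q t T′ a′ → a :* (q :* t :* (T′ :* T′) :* (a′ :* a′)) := a :* a′ :* (q :* T′ :* (t :* T′ :* a′)))
           refl a q t T′ (a ⁻¹) ⟩
    a * a ⁻¹ * (q * T′ * (t * T′ * a ⁻¹))
      ≈⟨ trans (*-congʳ (⁻¹-inverse a a≉0)) (*-identityˡ _) ⟩
    q * T′ * (t * T′ * a ⁻¹) ∎
    where
    open ≈-Reasoning
    T′ : Carrier
    T′ = pow (t ⁻¹) n
    [a²]⁻¹≈a⁻¹*a⁻¹ : pow a 2 ⁻¹ ≈ a ⁻¹ * a ⁻¹
    [a²]⁻¹≈a⁻¹*a⁻¹ = ⁻¹-unique (begin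
      a * (a * 1#) * (a ⁻¹ * a ⁻¹)  ≈⟨ solve 2 (λ a a′ → a :* (a :* con (+ 1)) :* (a′ :* a′) := a :* a′ :* (a :* a′))
           refl a (a ⁻¹) ⟩
      a * a ⁻¹ * (a * a ⁻¹)         ≈⟨ *-cong (⁻¹-inverse a a≉0) (⁻¹-inverse a a≉0) ⟩
      1# * 1#                       ≈⟨ *-identityˡ 1# ⟩
      1#                            ∎)

-- The identity also holds for n = 0 and r = 0.
lemma2 : ∀ {c ℓ : Level} (F : Field c ℓ) →
    let open Field F
        open FieldDefs F
    in (n : ℕ) → 1 ≤ n → (r : ℕ) → 1 ≤ r →
       (q t a : Carrier) →
       ¬ (q ≈ 0#) → ¬ (t ≈ 0#) → ¬ (a ≈ 0#) →
       (∀ k → k ≤ r → ¬ (qPoch q q k ≈ 0#)) →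
       (∀ k → k ≤ r → ¬ (qPoch (pow (t ⁻¹) n * (q * pow (q ⁻¹) r)) q k ≈ 0#)) →
       G r (geomPoint n t a) q t
         ≈ pow a r * (qPoch (pow t n) q r ÷ qPoch q q r)
             * phi21 r (pow (q ⁻¹) r) (pow t n) (pow (t ⁻¹) n * (q * pow (q ⁻¹) r)) q
                 (q * t * pow (t ⁻¹) (n +ℕ n) ÷ pow a 2)
lemma2 F n _ r _ q t a q≉0 t≉0 a≉0 qPoch-q≉0 qPoch-b≉0 = trans
  (geomPoint-product t≉0 a≉0 n ℕₚ.≤-refl)
  (qBinomialSeries-⊛-phi21 (⁻¹-inverse q q≉0) (pow-inverse n (⁻¹-inverse t t≉0))
    (rescale-argument a≉0 q t n) qPoch-q≉0 qPoch-b≉0)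
  where
  open Field F using (trans; ⁻¹-inverse)
  open QSeries F
  open QBinomial q r qPoch-q≉0
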